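{- Every van Benthem-formula $\phi$ has a local first-order frame correspondent: there is a formula $\alpha(x)$ of $L_0$ with $x$ as its only free variable such that for every Kripke frame $\mathcal{F}=(W,R)$ and every $w\in W$, $\mathcal{F},w\Vdash\phi$ iff $\mathcal{F}\models\alpha[x:=w]$.
   Context: Modal formulas are built by $\varphi::= p \mid \bot \mid \neg\varphi \mid \varphi\vee\varphi \mid \Diamond\varphi$ over a set $\mathsf{Prop}$ of variables. A Kripke frame is $\mathcal{F}=(W,R)$ with $W\neq\emptyset$, $R\subseteq W\times W$; a valuation is $V:\mathsf{Prop}\to\mathcal{P}(W)$; truth is standard ($w\Vdash\Diamond\varphi$ iff some $R$-successor of $w$ satisfies $\varphi$), and $\mathcal{F},w\Vdash\phi$ means $\phi$ is true at $w$ under every valuation. $L_0$ is the first-order language with $=$ and a binary relation symbol $R$; $L_1$ extends $L_0$ with a unary predicate symbol $P$ for each $p\in\mathsf{Prop}$. The standard translation is $ST_x(p)=Px$, $ST_x(\bot)= x\neq x$, $ST_x(\neg\varphi)=\neg ST_x(\varphi)$, $ST_x(\varphi\vee\psi)=ST_x(\varphi)\vee ST_x(\psi)$, $ST_x(\Diamond\varphi)=\exists y(Rxy\wedge ST_y(\varphi))$ with $y$ fresh. A formula $\phi$ with variables $p_1,\dots,p_n$ is a van Benthem-formula if $\forall P_1\cdots\forall P_n\, ST_x(\phi)$ is equivalent to the same formula in which the second-order quantifiers range not over all subsets of the domain but only over those subsets definable by $L_0$-formulas (i.e.\ for every frame and every $w$, $ST_x(\phi)$ holds at $w$ for all interpretations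 of the $P_i$ iff it holds at $w$ for all interpretations of the $P_i$ by $L_0$-definable subsets). -}

module Defs where

open import Level using (0ℓ)
open import Data.Nat using (ℕ; zero; suc)
open import Data.Fin using (Fin; zero; suc)
open import Data.Empty using (⊥)
open import Data.Product using (Σ; ∃; _×_; _,_)
open import Data.Sum using (_⊎_)
open import Relation.Nullary using (¬_)
open import Relation.Binary.PropositionalEquality using (_≡_)
open import Function.Bundles using (_⇔_)

data MFormula : Set where
  var  : ℕ → MFormula
  bot  : MFormula
  neg  : MFormula → MFormula
  _or_ : MFormula → MFormula → MFormula
  dia  : MFormula → MFormula

-- Kripke frames (nonemptiness of W is automatic in the pointed
-- statements below, since a point w : W is always given)

record Frame : Set₁ where
  field
    W : Set
    R : W → W → Set
open Frame public

Valuation : Frame → Set₁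
Valuation F = ℕ → W F → Set

_,_,_⊩ₘ_ : (F : Frame) → Valuation F → W F → MFormula → Set
F , V , w ⊩ₘ var p    = V p w
F , V , w ⊩ₘ bot      = ⊥
F , V , w ⊩ₘ neg φ    = ¬ (F , V , w ⊩ₘ φ)
F , V , w ⊩ₘ (φ or ψ) = (F , V , w ⊩ₘ φ) ⊎ (F , V , w ⊩ₘ ψ)
F , V , w ⊩ₘ dia φ    = Σ (W F) λ v → R F w v × (F , V , v ⊩ₘ φ)

_,_⊩_ : (F : Frame) → W F → MFormula → Set₁
F , w ⊩ φ = (V : Valuation F) → F , V , w ⊩ₘ φ

-- L0 = FO ⊥      (no unary predicates)
--   L1 = FO ℕ      (a unary predicate P for each p ∈ Prop = ℕ)

data FO (A : Set) : ℕ → Set where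
  eq   : ∀ {n} → Fin n → Fin n → FO A n
  rel  : ∀ {n} → Fin n → Fin n → FO A n
  pred : ∀ {n} → A → Fin n → FO A n
  ff   : ∀ {n} → FO A n
  ¬'   : ∀ {n} → FO A n → FO A n
  _∨'_ : ∀ {n} → FO A n → FO A n → FO A n
  ∃'   : ∀ {n} → FO A (suc n) → FO A n   -- binds variable zero

L0 : ℕ → Set
L0 = FO ⊥

L1 : ℕ → Set
L1 = FO ℕ

_∧'_ : ∀ {A n} → FO A n → FO A n → FO A n
a ∧' b = ¬' (¬' a ∨' ¬' b)

_∷ₑ_ : {X : Set} {n : ℕ} → X → (Fin n → X) → Fin (suc n) → X
(x ∷ₑ ρ) zero    = x
(x ∷ₑ ρ) (suc i) = ρ i

sem : ∀ {A n} (F : Frame) → (A → W F → Set) → FO A n → (Fin n → W F) → Set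
sem F I (eq i j)   ρ = ρ i ≡ ρ j
sem F I (rel i j)  ρ = R F (ρ i) (ρ j)
sem F I (pred a i) ρ = I a (ρ i)
sem F I ff         ρ = ⊥
sem F I (¬' a)     ρ = ¬ sem F I a ρ
sem F I (a ∨' b)   ρ = sem F I a ρ ⊎ sem F I b ρ
sem F I (∃' a)     ρ = Σ (W F) λ v → sem F I a (v ∷ₑ ρ)

noPred : (F : Frame) → ⊥ → W F → Set
noPred F ()

_⊨₀_[_] : ∀ {n} (F : Frame) → L0 n → (Fin n → W F) → Set
F ⊨₀ α [ ρ ] = sem F (noPred F) α ρ

-- Standard translation (de Bruijn): ST x φ, with x : Fin n.
-- ST_x(◇φ) = ∃y (R x y ∧ ST_y φ), y fresh (= the newly bound index 0).

ST : ∀ {n} → Fin n → MFormula → L1 n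
ST x (var p)  = pred p x
ST x bot      = ¬' (eq x x)
ST x (neg φ)  = ¬' (ST x φ)
ST x (φ or ψ) = ST x φ ∨' ST x ψ
ST x (dia φ)  = ∃' (rel (suc x) zero ∧' ST zero φ)

STx : MFormula → L1 1
STx = ST zero

[_] : {X : Set} → X → Fin 1 → X
[ w ] = w ∷ₑ λ ()

-- L0-definable subsets (with parameters): S is definable in F if
-- S = { v | F ⊨ α[v, a₁ … aₘ] } for some L0-formula α(z, y₁ … yₘ)
-- and parameters a₁ … aₘ ∈ W.

Definable : (F : Frame) → (W F → Set) → Set
Definable F S =
  Σ ℕ λ m → Σ (L0 (suc m)) λ α → Σ (Fin m → W F) λ as →
    (v : W F) → S v ⇔ (F ⊨₀ α [ v ∷ₑ as ])

-- φ is a van Benthem-formula: for every frame and every w,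
--  ∀P₁…∀Pₙ ST_x(φ) holds at w   iff   it holds at w when the Pᵢ
--  range only over L0-definable subsets.
VanBenthem : MFormula → Set₁
VanBenthem φ =
  (F : Frame) (w : W F) →
    ((I : ℕ → W F → Set) → sem F I (STx φ) [ w ])
    ⇔
    ((I : ℕ → W F → Set) → ((k : ℕ) → Definable F (I k)) →
       sem F I (STx φ) [ w ])

LocalCorrespondent : MFormula → L0 1 → Set₁
LocalCorrespondent φ α =
  (F : Frame) (w : W F) → (F , w ⊩ φ) ⇔ (F ⊨₀ α [ [ w ] ])

module Submission where

-- If φ fails at w under some valuation, then, φ being a van Benthem formula, it fails under a
-- valuation by L0-definable sets, i.e. w refutes an L0 formula ∀ȳ ST_x(φ)[P⃗ := α⃗(·, ȳ)], a
-- substitution instance of φ. So Γ = {¬ST_x(φ)} ∪ {all instances} has no model, and by compactness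
-- already a finite part of Γ has none; the conjunction of the instances in that part is the
-- correspondent. Compactness (countable language, one constant) is proved by a Henkin construction:
-- enumerate the L1 sentences with constants from ℕ, keep each one that is consistent with every finite
-- part of Γ, adding a fresh witness to each existential, and build the term model of the resulting
-- complete theory, whose points are the least representatives of constants up to provable equality.
-- Excluded middle is used in Set for the classical connectives and in Set₁ to decide consistency.

open import Defs
open import Level using (0ℓ) renaming (suc to lsuc)
open import Axiom.ExcludedMiddle using (ExcludedMiddle)
open import Axiom.DoubleNegationElimination using (em⇒dne)
open import Data.Bool using (Bool; true; false; T)
open import Data.Empty using (⊥; ⊥-elim)
open import Data.Fin using (Fin; zero; suc; lift; splitAt; toℕ; fromℕ<; _↑ˡ_; _↑ʳ_)
open import Data.Fin.Properties using (fromℕ<-toℕ; toℕ<n)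
open import Data.List using (List; []; _∷_; _++_; length; applyUpTo)
open import Data.List.Membership.Propositional using (_∈_)
open import Data.List.Membership.Propositional.Properties using (∈-++⁺ʳ)
open import Data.List.Relation.Binary.Subset.Propositional using (_⊆_)
open import Data.List.Relation.Unary.All as All using (All; []; _∷_)
open import Data.List.Relation.Unary.All.Properties using (anti-mono; applyUpTo⁺₁; applyUpTo⁻)
open import Data.List.Relation.Unary.Any using (here; there)
open import Data.Maybe using (Maybe; just; nothing; zip; zipWith; fromMaybe) renaming (map to mapMaybe)
open import Data.Nat using (ℕ; zero; suc; _+_; _≟_; _≤_; _<_; _⊔_; z≤n; s≤s; _≤′_; ≤′-refl; ≤′-step)
open import Data.Nat.Properties
  using (≡-irrelevant; ≤-total; _<?_; +-suc; +-identityʳ; suc-injective; ≤-refl; ≤-trans; m≤m⊔n; m≤n⊔m;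
         <⇒≢; ≤-<-trans; <-≤-trans; ≤⇒≤′; <⇒≱; ≤∧≢⇒<; n≤1+n)
open import Data.Product using (Σ; _×_; _,_; proj₁; proj₂; uncurry; map₂)
open import Data.Product.Function.Dependent.Propositional using (congˡ)
open import Data.Product.Function.NonDependent.Propositional using (_×-⇔_)
open import Data.Sum using (_⊎_; inj₁; inj₂)
open import Data.Sum.Function.Propositional using (_⊎-⇔_)
open import Data.Unit using (tt)
open import Data.Vec using (Vec; []; _∷_; lookup; toList; fromList)
open import Data.Vec.Properties using (toList∘fromList)
open import Data.Vec.Functional using () renaming (_++_ to _++ₑ_)
open import Data.Vec.Functional.Properties using (lookup-++ˡ; lookup-++ʳ)
open import Function.Base using (_∘_; id; case_of_)
open import Function.Bundles using (_⇔_; mk⇔; Equivalence)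
open import Function.Properties.Equivalence using (⇔-isEquivalence)
open import Function.Related.Propositional using (equivalence)
open import Function.Related.TypeIsomorphisms using (¬-cong-⇔)
open import Relation.Binary.Structures using (IsEquivalence)
open import Relation.Binary.PropositionalEquality
  using (_≡_; _≢_; refl; sym; trans; cong; subst; subst₂; _≗_)
open import Relation.Nullary using (¬_; yes; no; contradiction)
open import Relation.Nullary.Decidable using (isYes; fromWitness; toWitness)

open Equivalence using (to; from)
module ⇔ = IsEquivalence (⇔-isEquivalence {0ℓ})

-- Logical equivalence and first-order semantics

Σ-⇔ : {X : Set} {P Q : X → Set} → (∀ x → P x ⇔ Q x) → Σ X P ⇔ Σ X Q
Σ-⇔ e = congˡ {k = equivalence} (e _)

Π-⇔ : {X : Set} {P Q : X → Set} → (∀ x → P x ⇔ Q x) → ((x : X) → P x) ⇔ ((x : X) → Q x)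
Π-⇔ e = mk⇔ (λ h x → to (e x) (h x)) (λ h x → from (e x) (h x))

∷ₑ-≗ : ∀ {X : Set} {n} (x : X) {ρ σ : Fin n → X} → ρ ≗ σ → (x ∷ₑ ρ) ≗ (x ∷ₑ σ)
∷ₑ-≗ x e zero    = refl
∷ₑ-≗ x e (suc i) = e i

sem-cong : ∀ {A n} (F : Frame) {I J : A → W F → Set} (ψ : FO A n) {ρ σ : Fin n → W F} →
           (∀ a v → I a v ⇔ J a v) → ρ ≗ σ → sem F I ψ ρ ⇔ sem F J ψ σ
sem-cong F (eq i j)   I⇔J e = mk⇔ (subst₂ _≡_ (e i) (e j)) (subst₂ _≡_ (sym (e i)) (sym (e j)))
sem-cong F (rel i j)  I⇔J e = mk⇔ (subst₂ (R F) (e i) (e j)) (subst₂ (R F) (sym (e i)) (sym (e j)))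
sem-cong F {I} {J} (pred a i) I⇔J e =
  mk⇔ (subst (J a) (e i) ∘ to (I⇔J a _)) (from (I⇔J a _) ∘ subst (J a) (sym (e i)))
sem-cong F ff         I⇔J e = ⇔.refl
sem-cong F (¬' ψ)     I⇔J e = ¬-cong-⇔ (sem-cong F ψ I⇔J e)
sem-cong F (ψ ∨' χ)   I⇔J e = sem-cong F ψ I⇔J e ⊎-⇔ sem-cong F χ I⇔J e
sem-cong F (∃' ψ)     I⇔J e = Σ-⇔ λ v → sem-cong F ψ I⇔J (∷ₑ-≗ v e)

sem-≗ : ∀ {A n} (F : Frame) (I : A → W F → Set) (ψ : FO A n) {ρ σ : Fin n → W F} →
        ρ ≗ σ → sem F I ψ ρ ⇔ sem F I ψ σ
sem-≗ F I ψ = sem-cong F ψ (λ _ _ → ⇔.refl)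

rename : ∀ {A n k} → (Fin n → Fin k) → FO A n → FO A k
rename r (eq i j)   = eq (r i) (r j)
rename r (rel i j)  = rel (r i) (r j)
rename r (pred a i) = pred a (r i)
rename r ff         = ff
rename r (¬' ψ)     = ¬' (rename r ψ)
rename r (ψ ∨' χ)   = rename r ψ ∨' rename r χ
rename r (∃' ψ)     = ∃' (rename (lift 1 r) ψ)

sem-rename : ∀ {A n k} (F : Frame) (I : A → W F → Set) (r : Fin n → Fin k) (ψ : FO A n)
             {ρ : Fin k → W F} {σ : Fin n → W F} →
             ρ ∘ r ≗ σ → sem F I (rename r ψ) ρ ⇔ sem F I ψ σ
sem-rename F I r (eq i j)   e = sem-≗ F I (eq i j) e
sem-rename F I r (rel i j)  e = sem-≗ F I (rel i j) e
sem-rename F I r (pred a i) e = sem-≗ F I (pred a i) e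
sem-rename F I r ff         e = ⇔.refl
sem-rename F I r (¬' ψ)     e = ¬-cong-⇔ (sem-rename F I r ψ e)
sem-rename F I r (ψ ∨' χ)   e = sem-rename F I r ψ e ⊎-⇔ sem-rename F I r χ e
sem-rename F I r (∃' ψ)     e = Σ-⇔ λ v → sem-rename F I (lift 1 r) ψ λ { zero → refl ; (suc i) → e i }

erasePreds : ∀ {A B n} → FO A n → FO B n
erasePreds (eq i j)   = eq i j
erasePreds (rel i j)  = rel i j
erasePreds (pred a i) = ff
erasePreds ff         = ff
erasePreds (¬' ψ)     = ¬' (erasePreds ψ)
erasePreds (ψ ∨' χ)   = erasePreds ψ ∨' erasePreds χ
erasePreds (∃' ψ)     = ∃' (erasePreds ψ)

emptyPreds : {A : Set} (F : Frame) → A → W F → Set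
emptyPreds F _ _ = ⊥

sem-erasePreds : ∀ {A B n} (F : Frame) (I : B → W F → Set) (ψ : FO A n) (ρ : Fin n → W F) →
                 sem F I (erasePreds ψ) ρ ⇔ sem F (emptyPreds F) ψ ρ
sem-erasePreds F I (eq i j)   ρ = ⇔.refl
sem-erasePreds F I (rel i j)  ρ = ⇔.refl
sem-erasePreds F I (pred a i) ρ = ⇔.refl
sem-erasePreds F I ff         ρ = ⇔.refl
sem-erasePreds F I (¬' ψ)     ρ = ¬-cong-⇔ (sem-erasePreds F I ψ ρ)
sem-erasePreds F I (ψ ∨' χ)   ρ = sem-erasePreds F I ψ ρ ⊎-⇔ sem-erasePreds F I χ ρ
sem-erasePreds F I (∃' ψ)     ρ = Σ-⇔ λ v → sem-erasePreds F I ψ (v ∷ₑ ρ)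

-- L0 has no predicate atoms, so erasing them is the inclusion of L0 into L1.
toL1 : ∀ {n} → L0 n → L1 n
toL1 = erasePreds

sem-toL1 : ∀ {n} (F : Frame) (I : ℕ → W F → Set) (α : L0 n) (ρ : Fin n → W F) →
           sem F I (toL1 α) ρ ⇔ (F ⊨₀ α [ ρ ])
sem-toL1 F I α ρ = ⇔.trans (sem-erasePreds F I α ρ) (sem-cong F α (λ ()) (λ _ → refl))

∷ₑ-++ₑ : ∀ {X : Set} {m n} (as : Fin (suc m) → X) (ρ : Fin n → X) →
         (as zero ∷ₑ (as ∘ suc ++ₑ ρ)) ≗ (as ++ₑ ρ)
∷ₑ-++ₑ as ρ zero = refl
∷ₑ-++ₑ {m = m} as ρ (suc i) with splitAt m i
... | inj₁ j = refl
... | inj₂ j = refl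

∀' : ∀ {A n} → FO A (suc n) → FO A n
∀' β = ¬' (∃' (¬' β))

∀ⁿ : ∀ {A} m {n} → FO A (m + n) → FO A n
∀ⁿ zero    β = β
∀ⁿ (suc m) β = ∀ⁿ m (∀' β)

⋀ : ∀ {A n} → List (FO A n) → FO A n
⋀ []       = ¬' ff
⋀ (ψ ∷ ψs) = ψ ∧' ⋀ ψs

module _ (em : ExcludedMiddle 0ℓ) where

  private
    dne : {P : Set} → ¬ ¬ P → P
    dne = em⇒dne em

  sem-∧' : ∀ {A n} (F : Frame) (I : A → W F → Set) (ψ χ : FO A n) (ρ : Fin n → W F) →
           sem F I (ψ ∧' χ) ρ ⇔ (sem F I ψ ρ × sem F I χ ρ)
  sem-∧' F I ψ χ ρ = mk⇔ (λ h → dne (h ∘ inj₁) , dne (h ∘ inj₂))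
                          (λ (x , y) → λ { (inj₁ ¬x) → ¬x x ; (inj₂ ¬y) → ¬y y })

  sem-∀' : ∀ {A n} (F : Frame) (I : A → W F → Set) (β : FO A (suc n)) (ρ : Fin n → W F) →
           sem F I (∀' β) ρ ⇔ ((v : W F) → sem F I β (v ∷ₑ ρ))
  sem-∀' F I β ρ = mk⇔ (λ h v → dne λ ¬β → h (v , ¬β)) (λ h (v , ¬β) → ¬β (h v))

  sem-∀ⁿ : ∀ {A} m {n} (F : Frame) (I : A → W F → Set) (β : FO A (m + n)) (ρ : Fin n → W F) →
           sem F I (∀ⁿ m β) ρ ⇔ ((as : Fin m → W F) → sem F I β (as ++ₑ ρ))
  sem-∀ⁿ zero    F I β ρ = mk⇔ (λ h _ → h) (λ h → h λ ())
  sem-∀ⁿ (suc m) F I β ρ = ⇔.trans (sem-∀ⁿ m F I (∀' β) ρ) (mk⇔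
    (λ h as → to (sem-≗ F I β (∷ₑ-++ₑ as ρ)) (to (sem-∀' F I β _) (h (as ∘ suc)) (as zero)))
    (λ h as → from (sem-∀' F I β _) λ v → from (sem-≗ F I β (∷ₑ-++ₑ (v ∷ₑ as) ρ)) (h (v ∷ₑ as))))

  sem-⋀ : ∀ {A n} (F : Frame) (I : A → W F → Set) (ψs : List (FO A n)) (ρ : Fin n → W F) →
          sem F I (⋀ ψs) ρ ⇔ All (λ ψ → sem F I ψ ρ) ψs
  sem-⋀ F I []       ρ = mk⇔ (λ _ → []) (λ _ ())
  sem-⋀ F I (ψ ∷ ψs) ρ = ⇔.trans (sem-∧' F I ψ (⋀ ψs) ρ) (mk⇔
    (λ (x , xs) → x ∷ to (sem-⋀ F I ψs ρ) xs)
    (λ { (x ∷ xs) → x , from (sem-⋀ F I ψs ρ) xs }))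

  sem-ST : ∀ {n} (F : Frame) (V : Valuation F) (φ : MFormula) (x : Fin n) (ρ : Fin n → W F) →
           sem F V (ST x φ) ρ ⇔ (F , V , ρ x ⊩ₘ φ)
  sem-ST F V (var p)  x ρ = ⇔.refl
  sem-ST F V bot      x ρ = mk⇔ (λ h → h refl) λ ()
  sem-ST F V (neg φ)  x ρ = ¬-cong-⇔ (sem-ST F V φ x ρ)
  sem-ST F V (φ or ψ) x ρ = sem-ST F V φ x ρ ⊎-⇔ sem-ST F V ψ x ρ
  sem-ST F V (dia φ)  x ρ = Σ-⇔ λ v →
    ⇔.trans (sem-∧' F V (rel (suc x) zero) (ST zero φ) (v ∷ₑ ρ)) (⇔.refl ×-⇔ sem-ST F V φ zero (v ∷ₑ ρ))

-- Substituting definable predicates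

Def : Set
Def = Σ ℕ λ m → L0 (suc m)

Params : Frame → Def → Set
Params F (m , α) = Fin m → W F

defined : (F : Frame) (d : Def) → Params F d → W F → Set
defined F (m , α) as v = F ⊨₀ α [ v ∷ₑ as ]

update : ∀ {ℓ} {Y : Set ℓ} → (ℕ → Y) → ℕ → Y → ℕ → Y
update g p y q with q ≟ p
... | yes _ = y
... | no  _ = g q

update-≡ : ∀ {ℓ} {Y : Set ℓ} (g : ℕ → Y) p y → update g p y p ≡ y
update-≡ g p y with p ≟ p
... | yes _   = refl
... | no  p≢p = contradiction refl p≢p

update-≢ : ∀ {ℓ} {Y : Set ℓ} (g : ℕ → Y) {p} y {q} → q ≢ p → update g p y q ≡ g q
update-≢ g {p} y {q} q≢p with q ≟ p
... | yes q≡p = contradiction q≡p q≢p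
... | no  _   = refl

-- Replaces each atom P_p x by α(x, ȳ): r moves the old variables and s places the parameters ȳ.
substPred : ∀ {n m k} → ℕ → L0 (suc m) → (Fin n → Fin k) → (Fin m → Fin k) → L1 n → L1 k
substPred p α r s (eq i j)   = eq (r i) (r j)
substPred p α r s (rel i j)  = rel (r i) (r j)
substPred p α r s (pred q i) with q ≟ p
... | yes _ = rename (r i ∷ₑ s) (toL1 α)
... | no  _ = pred q (r i)
substPred p α r s ff         = ff
substPred p α r s (¬' ψ)     = ¬' (substPred p α r s ψ)
substPred p α r s (ψ ∨' χ)   = substPred p α r s ψ ∨' substPred p α r s χ
substPred p α r s (∃' ψ)     = ∃' (substPred p α (lift 1 r) (suc ∘ s) ψ)

sem-substPred : ∀ {n m k} (F : Frame) (I : ℕ → W F → Set) (p : ℕ) (α : L0 (suc m))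
                (r : Fin n → Fin k) (s : Fin m → Fin k) (ψ : L1 n)
                {ρ : Fin k → W F} {σ : Fin n → W F} {as : Fin m → W F} →
                ρ ∘ r ≗ σ → ρ ∘ s ≗ as →
                sem F I (substPred p α r s ψ) ρ ⇔ sem F (update I p (defined F (m , α) as)) ψ σ
sem-substPred F I p α r s (eq i j)   er es = sem-≗ F I (eq i j) er
sem-substPred F I p α r s (rel i j)  er es = sem-≗ F I (rel i j) er
sem-substPred F I p α r s (pred q i) {σ = σ} {as} er es with q ≟ p
... | yes _ = ⇔.trans (sem-rename F I (r i ∷ₑ s) (toL1 α) λ { zero → er i ; (suc j) → es j })
                      (sem-toL1 F I α (σ i ∷ₑ as))
... | no  _ = sem-≗ F I (pred q i) er
sem-substPred F I p α r s ff         er es = ⇔.refl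
sem-substPred F I p α r s (¬' ψ)     er es = ¬-cong-⇔ (sem-substPred F I p α r s ψ er es)
sem-substPred F I p α r s (ψ ∨' χ)   er es =
  sem-substPred F I p α r s ψ er es ⊎-⇔ sem-substPred F I p α r s χ er es
sem-substPred F I p α r s (∃' ψ)     er es = Σ-⇔ λ v →
  sem-substPred F I p α (lift 1 r) (suc ∘ s) ψ (λ { zero → refl ; (suc i) → er i }) es

instantiateAt : ∀ {n} → ℕ → Def → L1 n → L1 n
instantiateAt {n} p (m , α) ψ = ∀ⁿ m (substPred p α (m ↑ʳ_) (_↑ˡ n) ψ)

instantiate : ∀ {n} → ℕ → List Def → L1 n → L1 n
instantiate p []       ψ = ψ
instantiate p (d ∷ ds) ψ = instantiate (suc p) ds (instantiateAt p d ψ)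

updateAll : (F : Frame) → (ℕ → W F → Set) → ℕ → (ds : List Def) → All (Params F) ds → ℕ → W F → Set
updateAll F I p []       []         = I
updateAll F I p (d ∷ ds) (as ∷ ass) = update (updateAll F I (suc p) ds ass) p (defined F d as)

module _ (em : ExcludedMiddle 0ℓ) where

  sem-instantiateAt : ∀ {n} (F : Frame) (I : ℕ → W F → Set) (p : ℕ) (d : Def) (ψ : L1 n)
                      (ρ : Fin n → W F) →
                      sem F I (instantiateAt p d ψ) ρ ⇔
                      ((as : Params F d) → sem F (update I p (defined F d as)) ψ ρ)
  sem-instantiateAt F I p (m , α) ψ ρ = ⇔.trans (sem-∀ⁿ em m F I _ ρ) (Π-⇔ λ as →
    sem-substPred F I p α _ _ ψ (lookup-++ʳ as ρ) (lookup-++ˡ as ρ))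

  sem-instantiate : ∀ {n} (F : Frame) (I : ℕ → W F → Set) (p : ℕ) (ds : List Def) (ψ : L1 n)
                    (ρ : Fin n → W F) →
                    sem F I (instantiate p ds ψ) ρ ⇔
                    ((ass : All (Params F) ds) → sem F (updateAll F I p ds ass) ψ ρ)
  sem-instantiate F I p []       ψ ρ = mk⇔ (λ { h [] → h }) (λ h → h [])
  sem-instantiate F I p (d ∷ ds) ψ ρ = ⇔.trans (sem-instantiate F I (suc p) ds _ ρ) (mk⇔
    (λ h → λ { (as ∷ ass) → to (sem-instantiateAt F _ p d ψ ρ) (h ass) as })
    (λ h ass → from (sem-instantiateAt F _ p d ψ ρ) λ as → h (as ∷ ass)))

-- Countable types

record Countable (X : Set) : Set where
  field
    encode        : X → ℕ
    decode        : ℕ → Maybe X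
    decode-encode : ∀ x → decode (encode x) ≡ just x
open Countable

next : ℕ × ℕ → ℕ × ℕ
next (zero  , b) = suc b , zero
next (suc a , b) = a , suc b

unpair : ℕ → ℕ × ℕ
unpair zero    = 0 , 0
unpair (suc k) = next (unpair k)

unpair-surjective : ∀ a b → Σ ℕ λ k → unpair k ≡ (a , b)
unpair-surjective a b = onDiagonal (a + b) a b refl
  where
  onDiagonal : ∀ s a b → a + b ≡ s → Σ ℕ λ k → unpair k ≡ (a , b)
  onDiagonal s       zero    zero    _ = 0 , refl
  onDiagonal zero    (suc a) zero    ()
  onDiagonal (suc s) (suc a) zero    e
    with k , u ← onDiagonal s zero a (suc-injective (trans (cong suc (sym (+-identityʳ a))) e))
    = suc k , cong next u
  onDiagonal s       a       (suc b) e
    with k , u ← onDiagonal s (suc a) b (trans (sym (+-suc a b)) e)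
    = suc k , cong next u

pair : ℕ → ℕ → ℕ
pair a b = proj₁ (unpair-surjective a b)

unpair-pair : ∀ a b → unpair (pair a b) ≡ (a , b)
unpair-pair a b = proj₂ (unpair-surjective a b)

ℕ-countable : Countable ℕ
ℕ-countable = record { encode = λ k → k ; decode = just ; decode-encode = λ _ → refl }

Fin-countable : ∀ n → Countable (Fin n)
Fin-countable n = record { encode = toℕ ; decode = decodeFin ; decode-encode = decodeFin-toℕ }
  where
  decodeFin : ℕ → Maybe (Fin n)
  decodeFin k with k <? n
  ... | yes k<n = just (fromℕ< k<n)
  ... | no  _   = nothing
  decodeFin-toℕ : ∀ i → decodeFin (toℕ i) ≡ just i
  decodeFin-toℕ i with toℕ i <? n
  ... | yes i<n = cong just (fromℕ<-toℕ i i<n)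
  ... | no  i≮n = contradiction (toℕ<n i) i≮n

retract-countable : ∀ {X Y : Set} (f : Y → X) (g : X → Y) → (∀ y → g (f y) ≡ y) →
                    Countable X → Countable Y
retract-countable f g gf cX = record
  { encode        = encode cX ∘ f
  ; decode        = mapMaybe g ∘ decode cX
  ; decode-encode = λ y → trans (cong (mapMaybe g) (decode-encode cX (f y))) (cong just (gf y))
  }

×-countable : ∀ {X Y : Set} → Countable X → Countable Y → Countable (X × Y)
×-countable cX cY = record
  { encode        = λ (x , y) → pair (encode cX x) (encode cY y)
  ; decode        = uncurry (λ i j → zip (decode cX i) (decode cY j)) ∘ unpair
  ; decode-encode = λ (x , y) → roundTrip x y
  }
  where
  roundTrip : ∀ x y → uncurry (λ i j → zip (decode cX i) (decode cY j))
                                (unpair (pair (encode cX x) (encode cY y))) ≡ just (x , y)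
  roundTrip x y
    rewrite unpair-pair (encode cX x) (encode cY y) | decode-encode cX x | decode-encode cY y = refl

Σℕ-countable : {P : ℕ → Set} → (∀ n → Countable (P n)) → Countable (Σ ℕ P)
Σℕ-countable {P} cP = record
  { encode        = λ (n , x) → pair n (encode (cP n) x)
  ; decode        = uncurry decodeAt ∘ unpair
  ; decode-encode = λ (n , x) → roundTrip n x
  }
  where
  decodeAt : ℕ → ℕ → Maybe (Σ ℕ P)
  decodeAt n j = mapMaybe (n ,_) (decode (cP n) j)
  roundTrip : ∀ n x → uncurry decodeAt (unpair (pair n (encode (cP n) x))) ≡ just (n , x)
  roundTrip n x rewrite unpair-pair n (encode (cP n) x) | decode-encode (cP n) x = refl

Vec-countable : ∀ {X : Set} → Countable X → ∀ n → Countable (Vec X n)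
Vec-countable cX zero    =
  record { encode = λ _ → 0 ; decode = λ _ → just [] ; decode-encode = λ { [] → refl } }
Vec-countable cX (suc n) =
  retract-countable (λ { (x ∷ xs) → x , xs }) (uncurry _∷_) (λ { (x ∷ xs) → refl })
                    (×-countable cX (Vec-countable cX n))

List-countable : ∀ {X : Set} → Countable X → Countable (List X)
List-countable cX =
  retract-countable (λ xs → length xs , fromList xs) (toList ∘ proj₂) toList∘fromList
                    (Σℕ-countable (Vec-countable cX))

⊥-countable : Countable ⊥
⊥-countable = record { encode = λ () ; decode = λ _ → nothing ; decode-encode = λ () }

module _ {A : Set} (cA : Countable A) where

  private
    indexPair : ∀ n → Countable (Fin n × Fin n)
    indexPair n = ×-countable (Fin-countable n) (Fin-countable n)

    predAtom : ∀ n → Countable (A × Fin n)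
    predAtom n = ×-countable cA (Fin-countable n)

  depth : ∀ {n} → FO A n → ℕ
  depth (eq i j)   = 0
  depth (rel i j)  = 0
  depth (pred a i) = 0
  depth ff         = 0
  depth (¬' ψ)     = suc (depth ψ)
  depth (ψ ∨' χ)   = suc (depth ψ ⊔ depth χ)
  depth (∃' ψ)     = suc (depth ψ)

  encodeFO : ∀ {n} → FO A n → ℕ
  encodeFO {n} (eq i j)   = pair 0 (encode (indexPair n) (i , j))
  encodeFO {n} (rel i j)  = pair 1 (encode (indexPair n) (i , j))
  encodeFO {n} (pred a i) = pair 2 (encode (predAtom n) (a , i))
  encodeFO ff             = pair 3 0
  encodeFO (¬' ψ)         = pair 4 (encodeFO ψ)
  encodeFO (ψ ∨' χ)       = pair 5 (pair (encodeFO ψ) (encodeFO χ))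
  encodeFO (∃' ψ)         = pair 6 (encodeFO ψ)

  -- The components of a Cantor code are not structurally smaller, so decoding runs on fuel;
  -- depth ψ + 1 suffices, and the depth is stored alongside the code.
  decodeFO : (fuel : ℕ) → (n : ℕ) → ℕ → Maybe (FO A n)
  decodeTagged : (fuel : ℕ) → (n : ℕ) → (tag : ℕ) → ℕ → Maybe (FO A n)
  decodeFO zero       n k = nothing
  decodeFO (suc fuel) n k = uncurry (decodeTagged fuel n) (unpair k)
  decodeTagged fuel n 0 k = mapMaybe (uncurry eq) (decode (indexPair n) k)
  decodeTagged fuel n 1 k = mapMaybe (uncurry rel) (decode (indexPair n) k)
  decodeTagged fuel n 2 k = mapMaybe (uncurry pred) (decode (predAtom n) k)
  decodeTagged fuel n 3 k = just ff
  decodeTagged fuel n 4 k = mapMaybe ¬' (decodeFO fuel n k)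
  decodeTagged fuel n 5 k =
    uncurry (λ i j → zipWith _∨'_ (decodeFO fuel n i) (decodeFO fuel n j)) (unpair k)
  decodeTagged fuel n 6 k = mapMaybe ∃' (decodeFO fuel (suc n) k)
  decodeTagged fuel n _ k = nothing

  decodeFO-encodeFO : ∀ {n} (ψ : FO A n) {fuel} → depth ψ < fuel → decodeFO fuel n (encodeFO ψ) ≡ just ψ
  decodeFO-encodeFO {n} (eq i j) {suc _} _
    rewrite unpair-pair 0 (encode (indexPair n) (i , j)) | decode-encode (indexPair n) (i , j) = refl
  decodeFO-encodeFO {n} (rel i j) {suc _} _
    rewrite unpair-pair 1 (encode (indexPair n) (i , j)) | decode-encode (indexPair n) (i , j) = refl
  decodeFO-encodeFO {n} (pred a i) {suc _} _
    rewrite unpair-pair 2 (encode (predAtom n) (a , i)) | decode-encode (predAtom n) (a , i) = refl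
  decodeFO-encodeFO ff {suc _} _ rewrite unpair-pair 3 0 = refl
  decodeFO-encodeFO (¬' ψ) {suc _} (s≤s d<f)
    rewrite unpair-pair 4 (encodeFO ψ) | decodeFO-encodeFO ψ d<f = refl
  decodeFO-encodeFO (ψ ∨' χ) {suc _} (s≤s d<f)
    rewrite unpair-pair 5 (pair (encodeFO ψ) (encodeFO χ)) | unpair-pair (encodeFO ψ) (encodeFO χ)
          | decodeFO-encodeFO ψ (≤-trans (s≤s (m≤m⊔n (depth ψ) (depth χ))) d<f)
          | decodeFO-encodeFO χ (≤-trans (s≤s (m≤n⊔m (depth ψ) (depth χ))) d<f) = refl
  decodeFO-encodeFO (∃' ψ) {suc _} (s≤s d<f)
    rewrite unpair-pair 6 (encodeFO ψ) | decodeFO-encodeFO ψ d<f = refl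

  FO-countable : ∀ n → Countable (FO A n)
  FO-countable n = record
    { encode        = λ ψ → pair (depth ψ) (encodeFO ψ)
    ; decode        = uncurry (λ d k → decodeFO (suc d) n k) ∘ unpair
    ; decode-encode = roundTrip
    }
    where
    roundTrip : ∀ ψ → uncurry (λ d k → decodeFO (suc d) n k) (unpair (pair (depth ψ) (encodeFO ψ))) ≡ just ψ
    roundTrip ψ rewrite unpair-pair (depth ψ) (encodeFO ψ) = decodeFO-encodeFO ψ ≤-refl

-- Compactness

Sentence : Set
Sentence = Σ ℕ λ n → L1 n × Vec ℕ n

-- Opaque: unfolding concrete codes during unification exhausts memory.
opaque
  Sentence-countable : Countable Sentence
  Sentence-countable =
    Σℕ-countable λ n → ×-countable (FO-countable ℕ-countable n) (Vec-countable ℕ-countable n)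

record Structure : Set₁ where
  field
    frame  : Frame
    preds  : ℕ → W frame → Set
    consts : ℕ → W frame
open Structure

infix 4 _⊨_
infixl 5 _⟨_↦_⟩

_⊨_ : Structure → Sentence → Set
M ⊨ (n , ψ , c) = sem (frame M) (preds M) ψ (consts M ∘ lookup c)

_⟨_↦_⟩ : (M : Structure) → ℕ → W (frame M) → Structure
M ⟨ f ↦ v ⟩ = record M { consts = update (consts M) f v }

⊨-at0 : ∀ (M : Structure) (ψ : L1 1) → M ⊨ (1 , ψ , 0 ∷ []) ⇔ sem (frame M) (preds M) ψ [ consts M 0 ]
⊨-at0 M ψ = sem-≗ (frame M) (preds M) ψ λ { zero → refl }

maxVec : ∀ {n} → Vec ℕ n → ℕ
maxVec []       = 0
maxVec (x ∷ xs) = x ⊔ maxVec xs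

lookup≤maxVec : ∀ {n} (c : Vec ℕ n) i → lookup c i ≤ maxVec c
lookup≤maxVec (x ∷ c) zero    = m≤m⊔n x (maxVec c)
lookup≤maxVec (x ∷ c) (suc i) = ≤-trans (lookup≤maxVec c i) (m≤n⊔m x (maxVec c))

maxConst : List Sentence → ℕ
maxConst []                = 0
maxConst ((_ , _ , c) ∷ l) = maxVec c ⊔ maxConst l

maxVec≤maxConst : ∀ {n ψ c l} → (n , ψ , c) ∈ l → maxVec c ≤ maxConst l
maxVec≤maxConst {c = c} {_ ∷ l} (here refl) = m≤m⊔n (maxVec c) (maxConst l)
maxVec≤maxConst {l = (_ , _ , c') ∷ l} (there s∈l) =
  ≤-trans (maxVec≤maxConst s∈l) (m≤n⊔m (maxVec c') (maxConst l))

fresh : List Sentence → ℕ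
fresh l = suc (maxConst l)

⊨-fresh : ∀ (M : Structure) {f} v {n} (ψ : L1 n) (c : Vec ℕ n) → maxVec c < f →
          (M ⟨ f ↦ v ⟩) ⊨ (n , ψ , c) ⇔ M ⊨ (n , ψ , c)
⊨-fresh M v ψ c c<f = sem-≗ (frame M) (preds M) ψ λ i →
  update-≢ (consts M) v (<⇒≢ (≤-<-trans (lookup≤maxVec c i) c<f))

-- The least d ≤ n with T (f d), and n if there is none.
least : (ℕ → Bool) → ℕ → ℕ
least f zero    = zero
least f (suc n) with f zero
... | true  = zero
... | false = suc (least (f ∘ suc) n)

least-holds : ∀ (f : ℕ → Bool) {m n} → T (f m) → m ≤ n → T (f (least f n))
least-holds f {zero}  {zero}  fm _ = fm
least-holds f {zero}  {suc n} fm _ with f zero in e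
... | true  = subst T (sym e) tt
... | false = ⊥-elim fm
least-holds f {suc m} {suc n} fm (s≤s m≤n) with f zero in e
... | true  = subst T (sym e) tt
... | false = least-holds (f ∘ suc) fm m≤n

least-stable : ∀ (f : ℕ → Bool) {m n} → T (f m) → m ≤ n → least f n ≡ least f m
least-stable f {zero}  {zero}  fm _ = refl
least-stable f {zero}  {suc n} fm _ with f zero
... | true  = refl
... | false = ⊥-elim fm
least-stable f {suc m} {suc n} fm (s≤s m≤n) with f zero
... | true  = refl
... | false = cong suc (least-stable (f ∘ suc) fm m≤n)

least-unique : ∀ (f : ℕ → Bool) {m n} → T (f m) → T (f n) → least f m ≡ least f n
least-unique f {m} {n} fm fn with ≤-total m n
... | inj₁ m≤n = sym (least-stable f fm m≤n)
... | inj₂ n≤m = least-stable f fn n≤m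

least-cong : ∀ (f g : ℕ → Bool) n → (∀ d → T (f d) → T (g d)) → (∀ d → T (g d) → T (f d)) →
             least f n ≡ least g n
least-cong f g zero    f⇒g g⇒f = refl
least-cong f g (suc n) f⇒g g⇒f with f zero in e₁ | g zero in e₂
... | true  | true  = refl
... | false | false = cong suc (least-cong (f ∘ suc) (g ∘ suc) n (f⇒g ∘ suc) (g⇒f ∘ suc))
... | true  | false = ⊥-elim (subst T e₂ (f⇒g 0 (subst T (sym e₁) tt)))
... | false | true  = ⊥-elim (subst T e₁ (g⇒f 0 (subst T (sym e₂) tt)))

module Henkin (em₀ : ExcludedMiddle 0ℓ) (em₁ : ExcludedMiddle (lsuc 0ℓ)) (Γ : ℕ → L1 1) where

  axiom : ℕ → Sentence
  axiom i = 1 , Γ i , 0 ∷ []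

  Consistent : List Sentence → Set₁
  Consistent l = ∀ m → Σ Structure λ M → (∀ i → i < m → M ⊨ axiom i) × All (M ⊨_) l

  consistent-⊆ : ∀ {l l'} → l ⊆ l' → Consistent l' → Consistent l
  consistent-⊆ l⊆l' h m = map₂ (map₂ (anti-mono l⊆l')) (h m)

  witness-consistent : ∀ {n} (ψ : L1 (suc n)) (c : Vec ℕ n) l → Consistent ((n , ∃' ψ , c) ∷ l) →
                       Consistent ((suc n , ψ , fresh ((n , ∃' ψ , c) ∷ l) ∷ c) ∷ (n , ∃' ψ , c) ∷ l)
  witness-consistent {n} ψ c l h m with h m
  ... | M , ax , ((v , ⊨ψ) ∷ ⊨l) =
    M ⟨ f ↦ v ⟩ , ax′ , ⊨witness ∷ from (⊨-fresh M v (∃' ψ) c c<f) (v , ⊨ψ) ∷ ⊨l′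
    where
    f = fresh ((n , ∃' ψ , c) ∷ l)
    c<f : maxVec c < f
    c<f = s≤s (m≤m⊔n (maxVec c) (maxConst l))
    ax′ : ∀ i → i < m → M ⟨ f ↦ v ⟩ ⊨ axiom i
    ax′ i i<m = from (⊨-fresh M v (Γ i) (0 ∷ []) (s≤s z≤n)) (ax i i<m)
    ⊨l′ : All (M ⟨ f ↦ v ⟩ ⊨_) l
    ⊨l′ = All.tabulate λ { {k , χ , c′} t∈l → from (⊨-fresh M v χ c′
            (s≤s (≤-trans (maxVec≤maxConst t∈l) (m≤n⊔m (maxVec c) (maxConst l))))) (All.lookup ⊨l t∈l) }
    ⊨witness : M ⟨ f ↦ v ⟩ ⊨ (suc n , ψ , f ∷ c)
    ⊨witness = from (sem-≗ (frame M) (preds M) ψ λ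
      { zero    → update-≡ (consts M) f v
      ; (suc i) → update-≢ (consts M) v (<⇒≢ (≤-<-trans (lookup≤maxVec c i) c<f)) }) ⊨ψ

  henkinWitness : Sentence → List Sentence → List Sentence
  henkinWitness s@(n , ∃' ψ , c) l = (suc n , ψ , fresh (s ∷ l) ∷ c) ∷ []
  henkinWitness _                l = []

  henkinWitness-consistent : ∀ s l → Consistent (s ∷ l) → Consistent (henkinWitness s l ++ s ∷ l)
  henkinWitness-consistent (n , eq i j   , c) l = id
  henkinWitness-consistent (n , rel i j  , c) l = id
  henkinWitness-consistent (n , pred a i , c) l = id
  henkinWitness-consistent (n , ff       , c) l = id
  henkinWitness-consistent (n , ¬' ψ     , c) l = id
  henkinWitness-consistent (n , ψ ∨' χ   , c) l = id
  henkinWitness-consistent (n , ∃' ψ     , c) l = witness-consistent ψ c l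

  enumerate : ℕ → Sentence
  enumerate k = fromMaybe (0 , ff , []) (decode Sentence-countable k)

  index : Sentence → ℕ
  index = encode Sentence-countable

  enumerate-index : ∀ s → enumerate (index s) ≡ s
  enumerate-index s = cong (fromMaybe _) (decode-encode Sentence-countable s)

  extendWith : Sentence → List Sentence → List Sentence
  extendWith s l with em₁ {Consistent (s ∷ l)}
  ... | yes _ = henkinWitness s l ++ s ∷ l
  ... | no  _ = l

  ⊆-extendWith : ∀ s l → l ⊆ extendWith s l
  ⊆-extendWith s l with em₁ {Consistent (s ∷ l)}
  ... | yes _ = ∈-++⁺ʳ (henkinWitness s l) ∘ there
  ... | no  _ = id

  extendWith-accepts : ∀ s l → Consistent (s ∷ l) → henkinWitness s l ++ s ∷ l ⊆ extendWith s l
  extendWith-accepts s l h with em₁ {Consistent (s ∷ l)}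
  ... | yes _ = id
  ... | no ¬h = contradiction h ¬h

  extendWith-consistent : ∀ s l → Consistent l → Consistent (extendWith s l)
  extendWith-consistent s l h with em₁ {Consistent (s ∷ l)}
  ... | yes h′ = henkinWitness-consistent s l h′
  ... | no  _  = h

  stage : ℕ → List Sentence
  stage zero    = []
  stage (suc k) = extendWith (enumerate k) (stage k)

  stage-mono : ∀ {k k′} → k ≤ k′ → stage k ⊆ stage k′
  stage-mono = mono′ ∘ ≤⇒≤′
    where
    mono′ : ∀ {k k′} → k ≤′ k′ → stage k ⊆ stage k′
    mono′ ≤′-refl            = id
    mono′ (≤′-step {k′} k≤k′) = ⊆-extendWith (enumerate k′) (stage k′) ∘ mono′ k≤k′

  stage-suc-index : ∀ s → stage (suc (index s)) ≡ extendWith s (stage (index s))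
  stage-suc-index s = cong (λ t → extendWith t (stage (index s))) (enumerate-index s)

  ¬ₛ_ : Sentence → Sentence
  ¬ₛ (n , ψ , c) = n , ¬' ψ , c

  private
    ¬∀⇒∃¬ : {P : ℕ → Set₁} → ¬ (∀ m → P m) → Σ ℕ λ m → ¬ P m
    ¬∀⇒∃¬ h = em⇒dne em₁ λ ¬∃ → h λ m → em⇒dne em₁ λ ¬Pm → ¬∃ (m , ¬Pm)

  module Lindenbaum (consistent-[] : Consistent []) where

    stage-consistent : ∀ k → Consistent (stage k)
    stage-consistent zero    = consistent-[]
    stage-consistent (suc k) = extendWith-consistent (enumerate k) (stage k) (stage-consistent k)

    ¬both-inconsistent : ∀ s k₁ k₂ → ¬ Consistent (s ∷ stage k₁) → ¬ Consistent (¬ₛ s ∷ stage k₂) → ⊥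
    ¬both-inconsistent s k₁ k₂ ¬h₁ ¬h₂
      with m₁ , ¬h₁′ ← ¬∀⇒∃¬ ¬h₁ | m₂ , ¬h₂′ ← ¬∀⇒∃¬ ¬h₂
      with M , ax , sat ← stage-consistent (k₁ ⊔ k₂) (m₁ ⊔ m₂) | em₀ {M ⊨ s}
    ... | yes ⊨s = ¬h₁′ (M , (λ i i<m → ax i (<-≤-trans i<m (m≤m⊔n m₁ m₂))) ,
                         ⊨s ∷ anti-mono (stage-mono (m≤m⊔n k₁ k₂)) sat)
    ... | no ⊭s  = ¬h₂′ (M , (λ i i<m → ax i (<-≤-trans i<m (m≤n⊔m m₁ m₂))) ,
                         ⊭s ∷ anti-mono (stage-mono (m≤n⊔m k₁ k₂)) sat)

    -- Membership in the complete theory ⋃ₖ stage k, Bool-valued so that it lives in Set.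
    isTh : Sentence → Bool
    isTh s = isYes (em₁ {Consistent (s ∷ stage (index s))})

    Th : Sentence → Set
    Th s = T (isTh s)

    ∈stage⇒Th : ∀ {s j} → s ∈ stage j → Th s
    ∈stage⇒Th {s} {j} s∈ = fromWitness (consistent-⊆ s∷stage⊆ (stage-consistent (j ⊔ index s)))
      where
      s∷stage⊆ : s ∷ stage (index s) ⊆ stage (j ⊔ index s)
      s∷stage⊆ (here refl) = stage-mono (m≤m⊔n j (index s)) s∈
      s∷stage⊆ (there t∈) = stage-mono (m≤n⊔m j (index s)) t∈

    Th⇒accepted : ∀ {s} → Th s →
                  henkinWitness s (stage (index s)) ++ s ∷ stage (index s) ⊆ stage (suc (index s))
    Th⇒accepted {s} t = subst (henkinWitness s (stage (index s)) ++ s ∷ stage (index s) ⊆_)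
                               (sym (stage-suc-index s)) (extendWith-accepts s _ (toWitness t))

    Th-witness : ∀ {n ψ c} → Th (n , ∃' ψ , c) → Σ ℕ λ d → Th (suc n , ψ , d ∷ c)
    Th-witness {n} {ψ} {c} t =
      fresh (s ∷ stage (index s)) , ∈stage⇒Th {j = suc (index s)} (Th⇒accepted {s} t (here refl))
      where s = n , ∃' ψ , c

    Th-bounded : ∀ {l} → All Th l → Σ ℕ λ k → l ⊆ stage k
    Th-bounded []                 = 0 , λ ()
    Th-bounded {s ∷ _} (t ∷ ts) with k , l⊆ ← Th-bounded ts =
      suc (index s) ⊔ k ,
      λ { (here refl) → stage-mono (m≤m⊔n _ k) (Th⇒accepted {s} t (∈-++⁺ʳ _ (here refl)))
        ; (there u∈)  → stage-mono (m≤n⊔m (suc (index s)) k) (l⊆ u∈) }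

    Th-satisfiable : ∀ {l} → All Th l → Σ Structure λ M → All (M ⊨_) l
    Th-satisfiable ts with k , l⊆ ← Th-bounded ts = map₂ proj₂ (consistent-⊆ l⊆ (stage-consistent k) 0)

    Th-axiom : ∀ i → Th (axiom i)
    Th-axiom i = fromWitness λ m → let M , ax , sat = stage-consistent (index (axiom i)) (m ⊔ suc i) in
      M , (λ j j<m → ax j (<-≤-trans j<m (m≤m⊔n m (suc i)))) , ax i (m≤n⊔m m (suc i)) ∷ sat

    Th-complete : ∀ s → Th s ⊎ Th (¬ₛ s)
    Th-complete s with em₀ {Th s} | em₀ {Th (¬ₛ s)}
    ... | yes t  | _      = inj₁ t
    ... | no _   | yes t  = inj₂ t
    ... | no ¬t  | no ¬t′ =
      ⊥-elim (¬both-inconsistent s (index s) (index (¬ₛ s)) (¬t ∘ fromWitness) (¬t′ ∘ fromWitness))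

    Th-closed : ∀ {l} s → All Th l → (∀ M → All (M ⊨_) l → M ⊨ s) → Th s
    Th-closed s ts l⊨s with Th-complete s
    ... | inj₁ t = t
    ... | inj₂ t with M , ⊭s ∷ sat ← Th-satisfiable (t ∷ ts) = ⊥-elim (⊭s (l⊨s M sat))

    eqₛ : ℕ → ℕ → Sentence
    eqₛ a b = 2 , eq zero (suc zero) , a ∷ b ∷ []

    relₛ : ℕ → ℕ → Sentence
    relₛ a b = 2 , rel zero (suc zero) , a ∷ b ∷ []

    predₛ : ℕ → ℕ → Sentence
    predₛ k a = 1 , pred k zero , a ∷ []

    _≈_ : ℕ → ℕ → Set
    a ≈ b = Th (eqₛ a b)

    ≈-refl : ∀ a → a ≈ a
    ≈-refl a = Th-closed (eqₛ a a) [] λ _ _ → refl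

    ≈-sym : ∀ {a b} → a ≈ b → b ≈ a
    ≈-sym {a} {b} a≈b = Th-closed (eqₛ b a) (a≈b ∷ []) λ { _ (e ∷ []) → sym e }

    ≈-trans : ∀ {a b c} → a ≈ b → b ≈ c → a ≈ c
    ≈-trans {a} {b} {c} a≈b b≈c = Th-closed (eqₛ a c) (a≈b ∷ b≈c ∷ []) λ { _ (e ∷ e′ ∷ []) → trans e e′ }

    -- The least constant provably equal to c; these representatives are the points of the term model.
    rep : ℕ → ℕ
    rep c = least (λ d → isTh (eqₛ d c)) c

    rep≈ : ∀ c → rep c ≈ c
    rep≈ c = least-holds (λ d → isTh (eqₛ d c)) (≈-refl c) ≤-refl

    ≈⇒rep≡ : ∀ {a b} → a ≈ b → rep a ≡ rep b
    ≈⇒rep≡ {a} {b} a≈b = trans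
      (least-cong (λ d → isTh (eqₛ d a)) (λ d → isTh (eqₛ d b)) a
                  (λ _ d≈a → ≈-trans d≈a a≈b) (λ _ d≈b → ≈-trans d≈b (≈-sym a≈b)))
      (least-unique (λ d → isTh (eqₛ d b)) a≈b (≈-refl b))

    rep≡⇒≈ : ∀ {a b} → rep a ≡ rep b → a ≈ b
    rep≡⇒≈ {a} {b} e = ≈-trans (≈-sym (rep≈ a)) (subst (_≈ b) (sym e) (rep≈ b))

    Canonical : Set
    Canonical = Σ ℕ λ c → rep c ≡ c

    canon : ℕ → Canonical
    canon c = rep c , ≈⇒rep≡ (rep≈ c)

    Canonical-≡ : ∀ {x y : Canonical} → proj₁ x ≡ proj₁ y → x ≡ y
    Canonical-≡ {a , p} {.a , q} refl = cong (a ,_) (≡-irrelevant p q)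

    canon-proj₁ : ∀ x → canon (proj₁ x) ≡ x
    canon-proj₁ (c , rep≡c) = Canonical-≡ rep≡c

    termModel : Structure
    termModel = record
      { frame  = record { W = Canonical ; R = λ x y → Th (relₛ (proj₁ x) (proj₁ y)) }
      ; preds  = λ k x → Th (predₛ k (proj₁ x))
      ; consts = canon
      }

    private
      value : ∀ {n} → Vec ℕ n → Fin n → Canonical
      value c = canon ∘ lookup c

    truth-eq : ∀ {n} (i j : Fin n) c → Th (n , eq i j , c) ⇔ (value c i ≡ value c j)
    truth-eq i j c = mk⇔
      (λ t → Canonical-≡ (≈⇒rep≡ (Th-closed (eqₛ _ _) (t ∷ []) λ { _ (e ∷ []) → e })))
      (λ e → Th-closed (_ , eq i j , c) (rep≡⇒≈ (cong proj₁ e) ∷ []) λ { _ (e ∷ []) → e })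

    truth-rel : ∀ {n} (i j : Fin n) c → Th (n , rel i j , c) ⇔ R (frame termModel) (value c i) (value c j)
    truth-rel i j c = mk⇔
      (λ t → Th-closed (relₛ (rep a) (rep b)) (t ∷ rep≈ a ∷ rep≈ b ∷ [])
               λ { M (r ∷ e₁ ∷ e₂ ∷ []) → subst₂ (R (frame M)) (sym e₁) (sym e₂) r })
      (λ t → Th-closed (_ , rel i j , c) (t ∷ rep≈ a ∷ rep≈ b ∷ [])
               λ { M (r ∷ e₁ ∷ e₂ ∷ []) → subst₂ (R (frame M)) e₁ e₂ r })
      where
      a = lookup c i
      b = lookup c j

    truth-pred : ∀ {n} k (i : Fin n) c → Th (n , pred k i , c) ⇔ preds termModel k (value c i)
    truth-pred k i c = mk⇔
      (λ t → Th-closed (predₛ k (rep a)) (t ∷ rep≈ a ∷ [])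
               λ { M (p ∷ e ∷ []) → subst (preds M k) (sym e) p })
      (λ t → Th-closed (_ , pred k i , c) (t ∷ rep≈ a ∷ [])
               λ { M (p ∷ e ∷ []) → subst (preds M k) e p })
      where
      a = lookup c i

    truth-ff : ∀ {n} c → Th (n , ff , c) ⇔ ⊥
    truth-ff c = mk⇔ (λ t → case Th-satisfiable (t ∷ []) of λ { (_ , () ∷ []) }) λ ()

    truth-¬ : ∀ {n} (ψ : L1 n) c → Th (n , ψ , c) ⇔ termModel ⊨ (n , ψ , c) →
              Th (n , ¬' ψ , c) ⇔ (¬ termModel ⊨ (n , ψ , c))
    truth-¬ ψ c ih = mk⇔
      (λ t ⊨ψ → case Th-satisfiable (t ∷ from ih ⊨ψ ∷ []) of λ { (_ , ⊭ψ ∷ ⊨ψ′ ∷ []) → ⊭ψ ⊨ψ′ })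
      (λ ⊭ψ → case Th-complete (_ , ψ , c) of λ { (inj₁ t) → ⊥-elim (⊭ψ (to ih t)) ; (inj₂ t) → t })

    truth-∨ : ∀ {n} (ψ χ : L1 n) c →
              Th (n , ψ , c) ⇔ termModel ⊨ (n , ψ , c) → Th (n , χ , c) ⇔ termModel ⊨ (n , χ , c) →
              Th (n , ψ ∨' χ , c) ⇔ (termModel ⊨ (n , ψ , c) ⊎ termModel ⊨ (n , χ , c))
    truth-∨ ψ χ c ihψ ihχ = mk⇔ split
      λ { (inj₁ ⊨ψ) → Th-closed (_ , ψ ∨' χ , c) (from ihψ ⊨ψ ∷ []) λ { _ (x ∷ []) → inj₁ x }
        ; (inj₂ ⊨χ) → Th-closed (_ , ψ ∨' χ , c) (from ihχ ⊨χ ∷ []) λ { _ (x ∷ []) → inj₂ x } }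
      where
      split : Th (_ , ψ ∨' χ , c) → termModel ⊨ (_ , ψ , c) ⊎ termModel ⊨ (_ , χ , c)
      split t with Th-complete (_ , ψ , c) | Th-complete (_ , χ , c)
      ... | inj₁ tψ | _       = inj₁ (to ihψ tψ)
      ... | inj₂ _  | inj₁ tχ = inj₂ (to ihχ tχ)
      ... | inj₂ t¬ψ | inj₂ t¬χ with Th-satisfiable (t ∷ t¬ψ ∷ t¬χ ∷ [])
      ... | _ , inj₁ x ∷ ⊭ψ ∷ _ ∷ [] = ⊥-elim (⊭ψ x)
      ... | _ , inj₂ x ∷ _ ∷ ⊭χ ∷ [] = ⊥-elim (⊭χ x)

    truth-∃ : ∀ {n} (ψ : L1 (suc n)) c → (∀ d → Th (suc n , ψ , d ∷ c) ⇔ termModel ⊨ (suc n , ψ , d ∷ c)) →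
              Th (n , ∃' ψ , c) ⇔ Σ Canonical λ v → sem (frame termModel) (preds termModel) ψ (v ∷ₑ value c)
    truth-∃ ψ c ih = mk⇔
      (λ t → let d , t′ = Th-witness t in
        canon d , to (sem-≗ _ _ ψ λ { zero → refl ; (suc i) → refl }) (to (ih d) t′))
      (λ (v , ⊨ψ) → Th-closed (_ , ∃' ψ , c)
        (from (ih (proj₁ v)) (from (sem-≗ _ _ ψ λ { zero → canon-proj₁ v ; (suc i) → refl }) ⊨ψ) ∷ [])
        λ { M (x ∷ []) → consts M (proj₁ v) , to (sem-≗ _ _ ψ λ { zero → refl ; (suc i) → refl }) x })

    truth : ∀ {n} (ψ : L1 n) c → Th (n , ψ , c) ⇔ termModel ⊨ (n , ψ , c)
    truth (eq i j)   c = truth-eq i j c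
    truth (rel i j)  c = truth-rel i j c
    truth (pred k i) c = truth-pred k i c
    truth ff         c = truth-ff c
    truth (¬' ψ)     c = truth-¬ ψ c (truth ψ c)
    truth (ψ ∨' χ)   c = truth-∨ ψ χ c (truth ψ c) (truth χ c)
    truth (∃' ψ)     c = truth-∃ ψ c λ d → truth ψ (d ∷ c)

    termModel-axioms : ∀ i → termModel ⊨ axiom i
    termModel-axioms i = to (truth (Γ i) (0 ∷ [])) (Th-axiom i)

compactness : ExcludedMiddle 0ℓ → ExcludedMiddle (lsuc 0ℓ) → (Γ : ℕ → L1 1) →
              (∀ m → Σ Structure λ M → ∀ i → i < m → M ⊨ (1 , Γ i , 0 ∷ [])) →
              Σ Structure λ M → ∀ i → M ⊨ (1 , Γ i , 0 ∷ [])
compactness em₀ em₁ Γ finitelySatisfiable = termModel , termModel-axioms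
  where
  open Henkin em₀ em₁ Γ
  open Lindenbaum (λ m → map₂ (_, []) (finitelySatisfiable m))

-- Local correspondents of van Benthem formulas

varBound : MFormula → ℕ
varBound (var p)  = suc p
varBound bot      = 0
varBound (neg φ)  = varBound φ
varBound (φ or ψ) = varBound φ ⊔ varBound ψ
varBound (dia φ)  = varBound φ

⊩ₘ-local : ∀ (F : Frame) {V V′ : Valuation F} φ → (∀ q → q < varBound φ → ∀ v → V q v ⇔ V′ q v) →
           ∀ w → (F , V , w ⊩ₘ φ) ⇔ (F , V′ , w ⊩ₘ φ)
⊩ₘ-local F (var p)  V⇔V′ w = V⇔V′ p ≤-refl w
⊩ₘ-local F bot      V⇔V′ w = ⇔.refl
⊩ₘ-local F (neg φ)  V⇔V′ w = ¬-cong-⇔ (⊩ₘ-local F φ V⇔V′ w)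
⊩ₘ-local F (φ or ψ) V⇔V′ w =
  ⊩ₘ-local F φ (λ q q< → V⇔V′ q (<-≤-trans q< (m≤m⊔n _ _))) w ⊎-⇔
  ⊩ₘ-local F ψ (λ q q< → V⇔V′ q (<-≤-trans q< (m≤n⊔m _ _))) w
⊩ₘ-local F (dia φ)  V⇔V′ w = Σ-⇔ λ v → ⇔.refl ×-⇔ ⊩ₘ-local F φ V⇔V′ v

module _ {F : Frame} {S : W F → Set} (definable : Definable F S) where

  toDef : Def
  toDef = let m , α , _ = definable in m , α

  toParams : Params F toDef
  toParams = let _ , _ , as , _ = definable in as

  defined-toDef : ∀ v → defined F toDef toParams v ⇔ S v
  defined-toDef v = let _ , _ , _ , S⇔α = definable in ⇔.sym (S⇔α v)

module _ (F : Frame) (I : ℕ → W F → Set) (definable : ∀ k → Definable F (I k)) where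

  definitions : ℕ → ℕ → List Def
  definitions p zero    = []
  definitions p (suc n) = toDef (definable p) ∷ definitions (suc p) n

  parameters : ∀ p n → All (Params F) (definitions p n)
  parameters p zero    = []
  parameters p (suc n) = toParams (definable p) ∷ parameters (suc p) n

  updateAll-definitions : ∀ J p n q → p ≤ q → q < p + n → ∀ v →
                          updateAll F J p (definitions p n) (parameters p n) q v ⇔ I q v
  updateAll-definitions J p zero    q p≤q q<p+0 v =
    ⊥-elim (<⇒≱ (subst (q <_) (+-identityʳ p) q<p+0) p≤q)
  updateAll-definitions J p (suc n) q p≤q q<p+n v with q ≟ p
  ... | yes refl = defined-toDef (definable p) v
  ... | no  q≢p  =
    updateAll-definitions J (suc p) n q (≤∧≢⇒< p≤q (q≢p ∘ sym)) (subst (q <_) (+-suc p n) q<p+n) v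

opaque
  Defs-countable : Countable (List Def)
  Defs-countable = List-countable (Σℕ-countable λ m → FO-countable ⊥-countable (suc m))

enumerateDefs : ℕ → List Def
enumerateDefs = fromMaybe [] ∘ decode Defs-countable

enumerateDefs-encode : ∀ ds → enumerateDefs (encode Defs-countable ds) ≡ ds
enumerateDefs-encode ds = cong (fromMaybe []) (decode-encode Defs-countable ds)

pointed : (F : Frame) → Valuation F → W F → Structure
pointed F V w = record { frame = F ; preds = V ; consts = λ _ → w }

module Correspondence (em₀ : ExcludedMiddle 0ℓ) (φ : MFormula) where

  instanceOf : List Def → L0 1
  instanceOf ds = erasePreds (instantiate 0 ds (STx φ))

  ⊩⇒instance : ∀ F w → F , w ⊩ φ → ∀ ds → F ⊨₀ instanceOf ds [ [ w ] ]
  ⊩⇒instance F w ⊩φ ds =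
    from (sem-erasePreds F (noPred F) (instantiate 0 ds (STx φ)) [ w ])
      (from (sem-instantiate em₀ F (emptyPreds F) 0 ds (STx φ) [ w ]) λ _ →
        from (sem-ST em₀ F _ φ zero [ w ]) (⊩φ _))

  instance⇒⊩ : ∀ F w ds → F ⊨₀ instanceOf ds [ [ w ] ] →
               ∀ ass → F , updateAll F (emptyPreds F) 0 ds ass , w ⊩ₘ φ
  instance⇒⊩ F w ds h ass =
    to (sem-ST em₀ F _ φ zero [ w ])
      (to (sem-instantiate em₀ F (emptyPreds F) 0 ds (STx φ) [ w ])
        (to (sem-erasePreds F (noPred F) (instantiate 0 ds (STx φ)) [ w ]) h) ass)

  instances⇒STx-definable : ∀ F w → (∀ ds → F ⊨₀ instanceOf ds [ [ w ] ]) →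
                        (I : ℕ → W F → Set) → (∀ k → Definable F (I k)) → sem F I (STx φ) [ w ]
  instances⇒STx-definable F w instances I definable =
    from (sem-ST em₀ F I φ zero [ w ])
      (to (⊩ₘ-local F φ (λ q q<n v → updateAll-definitions F I definable (emptyPreds F) 0 n q z≤n q<n v) w)
        (instance⇒⊩ F w ds (instances ds) (parameters F I definable 0 n)))
    where
    n  = varBound φ
    ds = definitions F I definable 0 n

  Γ : ℕ → L1 1
  Γ zero    = ¬' (STx φ)
  Γ (suc i) = toL1 (instanceOf (enumerateDefs i))

  correspondent : ℕ → L0 1
  correspondent m = ⋀ (applyUpTo (instanceOf ∘ enumerateDefs) m)

  FinitelySatisfiable : ℕ → Set₁
  FinitelySatisfiable m = Σ Structure λ M → ∀ i → i < m → M ⊨ (1 , Γ i , 0 ∷ [])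

  correspondent-correct : ∀ m → ¬ FinitelySatisfiable m → LocalCorrespondent φ (correspondent m)
  correspondent-correct m ¬sat F w = mk⇔
    (λ ⊩φ → from (sem-⋀ em₀ F (noPred F) instances [ w ])
               (applyUpTo⁺₁ _ m λ {i} _ → ⊩⇒instance F w ⊩φ (enumerateDefs i)))
    (λ ⊨α V → case em₀ {F , V , w ⊩ₘ φ} of λ
      { (yes ⊩φ) → ⊩φ
      ; (no ⊮φ)  → ⊥-elim (¬sat (pointed F V w ,
                     satisfies ⊮φ (to (sem-⋀ em₀ F (noPred F) instances [ w ]) ⊨α))) })
    where
    instances : List (L0 1)
    instances = applyUpTo (instanceOf ∘ enumerateDefs) m
    satisfies : ∀ {V} → ¬ (F , V , w ⊩ₘ φ) → All (λ α → F ⊨₀ α [ [ w ] ]) instances →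
                ∀ i → i < m → pointed F V w ⊨ (1 , Γ i , 0 ∷ [])
    satisfies {V} ⊮φ ⊨αs zero    _   =
      from (⊨-at0 (pointed F V w) (Γ 0)) (⊮φ ∘ to (sem-ST em₀ F V φ zero [ w ]))
    satisfies {V} ⊮φ ⊨αs (suc i) i<m = from (⊨-at0 (pointed F V w) (Γ (suc i)))
      (from (sem-toL1 F V (instanceOf (enumerateDefs i)) [ w ])
        (applyUpTo⁻ _ m ⊨αs (≤-trans (n≤1+n (suc i)) i<m)))

  Γ-unsatisfiable : VanBenthem φ → ¬ (Σ Structure λ M → ∀ i → M ⊨ (1 , Γ i , 0 ∷ []))
  Γ-unsatisfiable vb (M , ⊨Γ) =
    to (⊨-at0 M (Γ 0)) (⊨Γ 0) (from (vb G w) (instances⇒STx-definable G w instances) J)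
    where
    G = frame M
    J = preds M
    w = consts M 0
    instances : ∀ ds → G ⊨₀ instanceOf ds [ [ w ] ]
    instances ds = to (sem-toL1 G J (instanceOf ds) [ w ])
      (subst (λ ds′ → sem G J (toL1 (instanceOf ds′)) [ w ]) (enumerateDefs-encode ds)
        (to (⊨-at0 M (Γ (suc k))) (⊨Γ (suc k))))
      where k = encode Defs-countable ds

theorem3p2 : ExcludedMiddle 0ℓ → ExcludedMiddle (lsuc 0ℓ) →
    (φ : MFormula) → VanBenthem φ →
    Σ (L0 1) λ α → LocalCorrespondent φ α
theorem3p2 em₀ em₁ φ vb = case em₁ {Σ ℕ λ m → ¬ FinitelySatisfiable m} of λ
  { (yes (m , ¬sat)) → correspondent m , correspondent-correct m ¬sat
  ; (no ¬∃)         → ⊥-elim (Γ-unsatisfiable vb (compactness em₀ em₁ Γ λ m →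
                          em⇒dne em₁ λ ¬sat → ¬∃ (m , ¬sat))) }
  where open Correspondence em₀ φ
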